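{- Let $T$ be a tile that is not a bar, and let $k,\ell$ be positive integers. Let $D^R,D^G,D^B$ be three $T$-packings of the $k\times\ell$ grid with row projections $\bar r^R,\bar r^G,\bar r^B\in\mathbb{N}^k$ and column projections $\bar s^R,\bar s^G,\bar s^B\in\mathbb{N}^\ell$. Let $\mathcal I$ be an instance $r^R,r^G,r^B\in\mathbb{N}^m$, $s^R,s^G,s^B\in\mathbb{N}^n$ of the 3-Color Tomography Problem satisfying $\sum_x r^c_x=\sum_y s^c_y$ for each $c\in\{R,G,B\}$, $\sum_c r^c_x=n$ for every $x\in[0,m)$ and $\sum_c s^c_y=m$ for every $y\in[0,n)$. Let $\mathcal J$ be the instance of $\mathrm{TPTP}(T)$ on the $mk\times n\ell$ grid with projections $r\in\mathbb{N}^{mk}$, $s\in\mathbb{N}^{n\ell}$ given by $r_{xk+i}=\sum_{c\in\{R,G,B\}} r^c_x\,\bar r^c_i$ and $s_{y\ell+j}=\sum_{c\in\{R,G,B\}} s^c_y\,\bar s^c_j$ for all $i\in[0,k)$, $j\in[0,\ell)$, $x\in[0,m)$, $y\in[0,n)$. Assume: (Requirement 1) $\bar r^R,\bar r^G,\bar r^B$ are affinely independent, and $\bar s^R,\bar s^G,\bar s^B$ are affinely independent; (Requirement 2) for every $T$-packing $D$ of the $mk\times n\ell$ grid with projections $r,s$ and every block $(x,y)$, the tiles of $D$ with positions in block $(x,y)$, translated by $(-xk,-y\ell)$, form a packing of the $k\times\ell$ grid whose projections equal $\bar r^c,\bar s^c$ for some $c\in\{R,G,B\}$. Then $\mathcal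 I$ has a solution if and only if $\mathcal J$ has a solution.
   Context: Grid cells are integer pairs; the $m\times n$ grid is $[0,m)\times[0,n)$. A tile is a finite nonempty set of cells connected under 4-adjacency, in canonical position (minimum row and column coordinates $0$); it is a bar if its bounding box has width or height $1$. $T+(i,j)=\{(x+i,y+j):(x,y)\in T\}$. A $T$-packing of a grid is a set $D$ of vectors such that all $T+(i,j)$, $(i,j)\in D$, lie in the grid and are pairwise disjoint; its projections are $r_i=|\{j:(i,j)\in D\}|$, $s_j=|\{i:(i,j)\in D\}|$. $\mathrm{TPTP}(T)$: given $r,s$, decide whether a $T$-packing with these projections exists. 3-Color Tomography Problem: given $r^R,r^G,r^B\in\mathbb{N}^m$, $s^R,s^G,s^B\in\mathbb{N}^n$, decide whether there is an $m\times n$ matrix $M$ with entries in $\{R,G,B\}$ with $r^c_x=|\{y:M_{xy}=c\}|$ and $s^c_y=|\{x:M_{xy}=c\}|$ for all $c,x,y$. Block $(x,y)$ of the $mk\times n\ell$ grid is $[xk,(x+1)k)\times[y\ell,(y+1)\ell)$; a tile copy at position $(i,j)$ lies in block $(x,y)$ if $(i,j)$ is in that rectangle. Vectors $v_1,\dots,v_t$ are affinely independent if $\sum\alpha_i=0$ and $\sum\alpha_i v_i=0$ imply all $\alpha_i=0$. -}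

module Defs where

open import Data.Nat using (ℕ; zero; suc; _+_; _*_; _<_)
open import Data.Bool using (Bool; true; false; if_then_else_)
open import Data.Fin using (Fin; toℕ; combine; remQuot)
import Data.Fin as F
open import Data.Product using (_×_; _,_; proj₁; proj₂; Σ; ∃; ∃-syntax)
open import Data.Sum using (_⊎_)
open import Data.List using (List)
open import Data.List.Membership.Propositional using (_∈_)
open import Data.Integer using (+_)
open import Data.Rational using (ℚ; 0ℚ; _/_) renaming (_+_ to _+ℚ_; _*_ to _*ℚ_)
open import Relation.Binary.PropositionalEquality using (_≡_; _≢_)
open import Relation.Nullary using (¬_)
open import Function.Bundles using (_⇔_)

-- Cells.  Since tiles are in canonical position (min row/column 0) and
-- packing positions are forced to be inside the grid, ℕ × ℕ suffices.
Cell : Set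
Cell = ℕ × ℕ

Adj : Cell → Cell → Set
Adj (a , b) (c , d) =
  (a ≡ c × (suc b ≡ d ⊎ suc d ≡ b)) ⊎ (b ≡ d × (suc a ≡ c ⊎ suc c ≡ a))

data Reach (S : List Cell) : Cell → Cell → Set where
  here : ∀ {p} → p ∈ S → Reach S p p
  step : ∀ {p q r} → p ∈ S → Adj p q → Reach S q r → Reach S p r

record Tile : Set where
  field
    cells     : List Cell
    nonempty  : ∃[ p ] (p ∈ cells)
    connected : ∀ {p q} → p ∈ cells → q ∈ cells → Reach cells p q
    minRow0   : ∃[ p ] (p ∈ cells × proj₁ p ≡ 0)
    minCol0   : ∃[ p ] (p ∈ cells × proj₂ p ≡ 0)
open Tile public

IsBar : Tile → Set
IsBar T = (∀ {p q} → p ∈ cells T → q ∈ cells T → proj₁ p ≡ proj₁ q)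
        ⊎ (∀ {p q} → p ∈ cells T → q ∈ cells T → proj₂ p ≡ proj₂ q)

sumF : ∀ {n} → (Fin n → ℕ) → ℕ
sumF {zero}  f = 0
sumF {suc n} f = f F.zero + sumF (λ i → f (F.suc i))

countF : ∀ {n} → (Fin n → Bool) → ℕ
countF f = sumF (λ i → if f i then 1 else 0)

-- A set D of position vectors in the M × N grid, given by its indicator.
-- (Any position of a tile copy lying in the grid is itself in [0,M)×[0,N),
-- since the canonical tile contains a cell in row 0 and one in column 0.)
Positions : ℕ → ℕ → Set
Positions M N = Fin M → Fin N → Bool

IsPacking : Tile → (M N : ℕ) → Positions M N → Set
IsPacking T M N D =
  (∀ i j → D i j ≡ true → ∀ {a b} → (a , b) ∈ cells T →
     (toℕ i + a < M) × (toℕ j + b < N))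
  × (∀ i j i′ j′ → D i j ≡ true → D i′ j′ ≡ true → (i , j) ≢ (i′ , j′) →
     ∀ {a b a′ b′} → (a , b) ∈ cells T → (a′ , b′) ∈ cells T →
     ¬ ((toℕ i + a ≡ toℕ i′ + a′) × (toℕ j + b ≡ toℕ j′ + b′)))

rowProj : ∀ {M N} → Positions M N → Fin M → ℕ
rowProj D i = countF (λ j → D i j)

colProj : ∀ {M N} → Positions M N → Fin N → ℕ
colProj D j = countF (λ i → D i j)

TPTPSolvable : Tile → (M N : ℕ) → (Fin M → ℕ) → (Fin N → ℕ) → Set
TPTPSolvable T M N r s =
  ∃[ D ] (IsPacking T M N D × (∀ i → rowProj D i ≡ r i) × (∀ j → colProj D j ≡ s j))

data Color : Set where
  R G B : Color

_==ᶜ_ : Color → Color → Bool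
R ==ᶜ R = true
G ==ᶜ G = true
B ==ᶜ B = true
_ ==ᶜ _ = false

ΣColor : (Color → ℕ) → ℕ
ΣColor f = f R + f G + f B

ThreeColorSolvable : (m n : ℕ) → (Color → Fin m → ℕ) → (Color → Fin n → ℕ) → Set
ThreeColorSolvable m n r s =
  Σ (Fin m → Fin n → Color) λ M →
    (∀ c x → countF (λ y → M x y ==ᶜ c) ≡ r c x)
    × (∀ c y → countF (λ x → M x y ==ᶜ c) ≡ s c y)

ℕtoℚ : ℕ → ℚ
ℕtoℚ n = (+ n) / 1

AffinelyIndependent3 : ∀ {k} → (Color → Fin k → ℕ) → Set
AffinelyIndependent3 v =
  ∀ (α : Color → ℚ) →
    (α R +ℚ α G) +ℚ α B ≡ 0ℚ →
    (∀ i → (α R *ℚ ℕtoℚ (v R i) +ℚ α G *ℚ ℕtoℚ (v G i)) +ℚ α B *ℚ ℕtoℚ (v B i) ≡ 0ℚ) →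
    ∀ c → α c ≡ 0ℚ

-- projections of the TPTP instance J:  r_{xk+i} = Σ_c r^c_x · r̄^c_i
-- (combine x i : Fin (m * k) has value x * k + i, and remQuot is its inverse)
rJ : ∀ {m} k → (Color → Fin m → ℕ) → (Color → Fin k → ℕ) → Fin (m * k) → ℕ
rJ {m} k r rbar z = ΣColor (λ c → r c (proj₁ (remQuot {m} k z)) * rbar c (proj₂ (remQuot {m} k z)))

block : ∀ {m n k ℓ} → Positions (m * k) (n * ℓ) → Fin m → Fin n → Positions k ℓ
block D x y i j = D (combine x i) (combine y j)

-- A 3-coloring M of the m × n matrix becomes a packing of the mk × nℓ grid by placing the
-- small packing D̄^{M x y} in block (x, y): row xk + i of it meets r̄^c_i tiles in each block of
-- color c of row x of M, so its projection is Σ_c r^c_x r̄^c_i as row x of M has r^c_x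
-- entries of each color c (and likewise for columns).  Conversely, Requirement 2 colors the blocks
-- of any packing solving J, and the same computation shows that the color counts (n_c) of row x
-- satisfy Σ_c n_c r̄^c = Σ_c r^c_x r̄^c with Σ_c n_c = n = Σ_c r^c_x; affine independence of
-- r̄^R, r̄^G, r̄^B then forces n_c = r^c_x.

module Submission where

open import Defs
open import Data.Nat using (ℕ; zero; suc; _+_; _*_; _<_)
open import Data.Nat.Properties using (+-assoc; +-identityʳ; *-distribʳ-+; +-commutativeSemigroup)
open import Data.Nat.Coprimality using (1-coprimeTo) renaming (sym to coprime-sym)
import Data.Integer as ℤ
open import Data.Integer.Properties using (pos-+; pos-*) renaming (+-injective to +-injectiveℤ; *-identityʳ to *ℤ-identityʳ)
open import Data.Rational using (ℚ; mkℚ; toℚᵘ; 0ℚ; -_; _-_) renaming (_+_ to _+ℚ_; _*_ to _*ℚ_)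
open import Data.Rational.Properties using (normalize-coprime; toℚᵘ-injective; toℚᵘ-homo-+; toℚᵘ-homo-*; mkℚ-injective; +-inverseʳ; neg-distrib-+; neg-distribˡ-*; +-0-group; +-0-commutativeMonoid) renaming (*-distribʳ-+ to *ℚ-distribʳ-+)
open import Data.Rational.Unnormalised using (*≡*; _≃_) renaming (_+_ to _+ᵘ_; _*_ to _*ᵘ_)
open import Data.Rational.Unnormalised.Properties using (≃-trans; ≃-sym)
open import Data.Fin using (Fin; toℕ; combine; remQuot; fromℕ<; _↑ˡ_; _↑ʳ_) renaming (zero to fzero; suc to fsuc)
open import Data.Fin.Properties using (toℕ-combine; toℕ-fromℕ<; toℕ<n; toℕ-injective; combine-remQuot; remQuot-combine; combine-injectiveˡ; combine-injectiveʳ)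
open import Data.Bool using (true; if_then_else_)
open import Data.Empty using (⊥)
open import Data.Product using (_×_; _,_; proj₁; proj₂; ∃-syntax)
open import Data.List.Membership.Propositional using (_∈_)
open import Relation.Binary.PropositionalEquality using (_≡_; _≢_; refl; sym; trans; cong; cong₂; subst; module ≡-Reasoning)
open import Relation.Nullary using (¬_)
open import Function using (flip)
open import Function.Bundles using (_⇔_; mk⇔; Equivalence)
open import Algebra.Bundles using (CommutativeMonoid)
open import Algebra.Properties.Group +-0-group using (x∙y⁻¹≈ε⇒x≈y)
import Algebra.Properties.CommutativeSemigroup as CommutativeSemigroupProperties

open CommutativeSemigroupProperties +-commutativeSemigroup using (interchange)
open CommutativeSemigroupProperties (CommutativeMonoid.commutativeSemigroup +-0-commutativeMonoid)
  using () renaming (interchange to interchangeℚ)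

-- ℕtoℚ n = + n / 1 is stuck on a gcd computation; the normal form below computes.
ℕtoℚ-nf : ℕ → ℚ
ℕtoℚ-nf n = mkℚ (ℤ.+ n) 0 (coprime-sym (1-coprimeTo n))

ℕtoℚ≡nf : ∀ n → ℕtoℚ n ≡ ℕtoℚ-nf n
ℕtoℚ≡nf n = normalize-coprime (coprime-sym (1-coprimeTo n))

ℕtoℚ-+ : ∀ a b → ℕtoℚ (a + b) ≡ ℕtoℚ a +ℚ ℕtoℚ b
ℕtoℚ-+ a b rewrite ℕtoℚ≡nf (a + b) | ℕtoℚ≡nf a | ℕtoℚ≡nf b =
  toℚᵘ-injective (≃-trans unnormalised (≃-sym (toℚᵘ-homo-+ (ℕtoℚ-nf a) (ℕtoℚ-nf b))))
  where
  unnormalised : toℚᵘ (ℕtoℚ-nf (a + b)) ≃ toℚᵘ (ℕtoℚ-nf a) +ᵘ toℚᵘ (ℕtoℚ-nf b)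
  unnormalised = *≡* (cong (ℤ._* ℤ.1ℤ) (trans (pos-+ a b)
    (sym (cong₂ ℤ._+_ (*ℤ-identityʳ (ℤ.+ a)) (*ℤ-identityʳ (ℤ.+ b))))))

ℕtoℚ-* : ∀ a b → ℕtoℚ (a * b) ≡ ℕtoℚ a *ℚ ℕtoℚ b
ℕtoℚ-* a b rewrite ℕtoℚ≡nf (a * b) | ℕtoℚ≡nf a | ℕtoℚ≡nf b =
  toℚᵘ-injective (≃-trans unnormalised (≃-sym (toℚᵘ-homo-* (ℕtoℚ-nf a) (ℕtoℚ-nf b))))
  where
  unnormalised : toℚᵘ (ℕtoℚ-nf (a * b)) ≃ toℚᵘ (ℕtoℚ-nf a) *ᵘ toℚᵘ (ℕtoℚ-nf b)
  unnormalised = *≡* (cong (ℤ._* ℤ.1ℤ) (pos-* a b))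

ℕtoℚ-injective : ∀ {a b} → ℕtoℚ a ≡ ℕtoℚ b → a ≡ b
ℕtoℚ-injective {a} {b} e rewrite ℕtoℚ≡nf a | ℕtoℚ≡nf b = +-injectiveℤ (proj₁ (mkℚ-injective e))

ΣColorℚ : (Color → ℚ) → ℚ
ΣColorℚ f = (f R +ℚ f G) +ℚ f B

ℕtoℚ-ΣColor : ∀ (f : Color → ℕ) → ℕtoℚ (ΣColor f) ≡ ΣColorℚ (λ c → ℕtoℚ (f c))
ℕtoℚ-ΣColor f = trans (ℕtoℚ-+ (f R + f G) (f B)) (cong (_+ℚ ℕtoℚ (f B)) (ℕtoℚ-+ (f R) (f G)))

+-minus-interchange : ∀ p q p′ q′ → (p +ℚ q) - (p′ +ℚ q′) ≡ (p - p′) +ℚ (q - q′)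
+-minus-interchange p q p′ q′ =
  trans (cong ((p +ℚ q) +ℚ_) (neg-distrib-+ p′ q′)) (interchangeℚ p q (- p′) (- q′))

ΣColorℚ-minus : ∀ (f g : Color → ℚ) → ΣColorℚ (λ c → f c - g c) ≡ ΣColorℚ f - ΣColorℚ g
ΣColorℚ-minus f g = sym (trans (+-minus-interchange (f R +ℚ f G) (f B) (g R +ℚ g G) (g B))
                           (cong (_+ℚ (f B - g B)) (+-minus-interchange (f R) (f G) (g R) (g G))))

ΣColor≡⇒ΣColorℚ-minus≡0 : ∀ (a b : Color → ℕ) → ΣColor a ≡ ΣColor b →
  ΣColorℚ (λ c → ℕtoℚ (a c) - ℕtoℚ (b c)) ≡ 0ℚ
ΣColor≡⇒ΣColorℚ-minus≡0 a b e = begin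
  ΣColorℚ (λ c → ℕtoℚ (a c) - ℕtoℚ (b c))
    ≡⟨ ΣColorℚ-minus (λ c → ℕtoℚ (a c)) (λ c → ℕtoℚ (b c)) ⟩
  ΣColorℚ (λ c → ℕtoℚ (a c)) - ΣColorℚ (λ c → ℕtoℚ (b c))
    ≡⟨ sym (cong₂ _-_ (ℕtoℚ-ΣColor a) (ℕtoℚ-ΣColor b)) ⟩
  ℕtoℚ (ΣColor a) - ℕtoℚ (ΣColor b)
    ≡⟨ cong (λ t → ℕtoℚ t - ℕtoℚ (ΣColor b)) e ⟩
  ℕtoℚ (ΣColor b) - ℕtoℚ (ΣColor b)
    ≡⟨ +-inverseʳ (ℕtoℚ (ΣColor b)) ⟩
  0ℚ ∎
  where open ≡-Reasoning

affine-combination-injective : ∀ {k} (v : Color → Fin k → ℕ) → AffinelyIndependent3 v →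
  (a b : Color → ℕ) → ΣColor a ≡ ΣColor b →
  (∀ i → ΣColor (λ c → a c * v c i) ≡ ΣColor (λ c → b c * v c i)) → ∀ c → a c ≡ b c
affine-combination-injective v independent a b Σa≡Σb combination≡ c =
  ℕtoℚ-injective (x∙y⁻¹≈ε⇒x≈y (ℕtoℚ (a c)) (ℕtoℚ (b c))
    (independent α (ΣColor≡⇒ΣColorℚ-minus≡0 a b Σa≡Σb) α-annihilates c))
  where
  α : Color → ℚ
  α c = ℕtoℚ (a c) - ℕtoℚ (b c)

  scale : ∀ i c → α c *ℚ ℕtoℚ (v c i) ≡ ℕtoℚ (a c * v c i) - ℕtoℚ (b c * v c i)
  scale i c = trans (*ℚ-distribʳ-+ (ℕtoℚ (v c i)) (ℕtoℚ (a c)) (- ℕtoℚ (b c)))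
    (sym (cong₂ _+ℚ_ (ℕtoℚ-* (a c) (v c i))
                     (trans (cong -_ (ℕtoℚ-* (b c) (v c i))) (neg-distribˡ-* (ℕtoℚ (b c)) (ℕtoℚ (v c i))))))

  α-annihilates : ∀ i → ΣColorℚ (λ c → α c *ℚ ℕtoℚ (v c i)) ≡ 0ℚ
  α-annihilates i = trans (cong₂ _+ℚ_ (cong₂ _+ℚ_ (scale i R) (scale i G)) (scale i B))
    (ΣColor≡⇒ΣColorℚ-minus≡0 (λ c → a c * v c i) (λ c → b c * v c i) (combination≡ i))

ΣColor-cong : ∀ {f g : Color → ℕ} → (∀ c → f c ≡ g c) → ΣColor f ≡ ΣColor g
ΣColor-cong e = cong₂ _+_ (cong₂ _+_ (e R) (e G)) (e B)

ΣColor-+ : ∀ (f g : Color → ℕ) → ΣColor (λ c → f c + g c) ≡ ΣColor f + ΣColor g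
ΣColor-+ f g = trans (cong (_+ (f B + g B)) (interchange (f R) (g R) (f G) (g G)))
                     (interchange (f R + f G) (g R + g G) (f B) (g B))

ΣColor-indicator : ∀ d → ΣColor (λ c → if d ==ᶜ c then 1 else 0) ≡ 1
ΣColor-indicator R = refl
ΣColor-indicator G = refl
ΣColor-indicator B = refl

ΣColor-select : ∀ (g : Color → ℕ) d → ΣColor (λ c → (if d ==ᶜ c then 1 else 0) * g c) ≡ g d
ΣColor-select g R = trans (+-identityʳ _) (trans (+-identityʳ _) (+-identityʳ (g R)))
ΣColor-select g G = trans (+-identityʳ _) (+-identityʳ (g G))
ΣColor-select g B = +-identityʳ (g B)

sumF-cong : ∀ {n} {f g : Fin n → ℕ} → (∀ i → f i ≡ g i) → sumF f ≡ sumF g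
sumF-cong {zero}  e = refl
sumF-cong {suc n} e = cong₂ _+_ (e fzero) (sumF-cong (λ i → e (fsuc i)))

ΣColor-countF : ∀ {n} (h : Fin n → Color) → ΣColor (λ c → countF (λ y → h y ==ᶜ c)) ≡ n
ΣColor-countF {zero}  h = refl
ΣColor-countF {suc n} h =
  trans (ΣColor-+ (λ c → if h fzero ==ᶜ c then 1 else 0) (λ c → countF (λ y → h (fsuc y) ==ᶜ c)))
        (cong₂ _+_ (ΣColor-indicator (h fzero)) (ΣColor-countF (λ y → h (fsuc y))))

sumF-by-color : ∀ {n} (h : Fin n → Color) (g : Color → ℕ) →
  sumF (λ y → g (h y)) ≡ ΣColor (λ c → countF (λ y → h y ==ᶜ c) * g c)
sumF-by-color {zero}  h g = refl
sumF-by-color {suc n} h g = begin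
  g (h fzero) + sumF (λ y → g (h (fsuc y)))
    ≡⟨ cong₂ _+_ (sym (ΣColor-select g (h fzero))) (sumF-by-color (λ y → h (fsuc y)) g) ⟩
  ΣColor (λ c → first c * g c) + ΣColor (λ c → rest c * g c)
    ≡⟨ sym (ΣColor-+ (λ c → first c * g c) (λ c → rest c * g c)) ⟩
  ΣColor (λ c → first c * g c + rest c * g c)
    ≡⟨ ΣColor-cong (λ c → sym (*-distribʳ-+ (g c) (first c) (rest c))) ⟩
  ΣColor (λ c → (first c + rest c) * g c) ∎
  where
  open ≡-Reasoning
  first rest : Color → ℕ
  first c = if h fzero ==ᶜ c then 1 else 0
  rest c = countF (λ y → h (fsuc y) ==ᶜ c)

color-counts⇒line-sums : ∀ {n k} (h : Fin n → Color) (v : Color → Fin k → ℕ) (ρ : Color → ℕ) →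
  (∀ c → countF (λ y → h y ==ᶜ c) ≡ ρ c) →
  ∀ i → sumF (λ y → v (h y) i) ≡ ΣColor (λ c → ρ c * v c i)
color-counts⇒line-sums h v ρ counts i =
  trans (sumF-by-color h (λ c → v c i)) (ΣColor-cong (λ c → cong (_* v c i) (counts c)))

-- The counts and ρ both sum to n, so the sums give an affine relation, which independence makes trivial.
line-sums⇒color-counts : ∀ {n k} (h : Fin n → Color) (v : Color → Fin k → ℕ) (ρ : Color → ℕ) →
  AffinelyIndependent3 v → ΣColor ρ ≡ n →
  (∀ i → sumF (λ y → v (h y) i) ≡ ΣColor (λ c → ρ c * v c i)) →
  ∀ c → countF (λ y → h y ==ᶜ c) ≡ ρ c
line-sums⇒color-counts h v ρ independent Σρ≡n sums =
  affine-combination-injective v independent (λ c → countF (λ y → h y ==ᶜ c)) ρ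
    (trans (ΣColor-countF h) (sym Σρ≡n))
    (λ i → trans (sym (sumF-by-color h (λ c → v c i))) (sums i))

sumF-↑ : ∀ a b (f : Fin (a + b) → ℕ) →
  sumF f ≡ sumF (λ (i : Fin a) → f (i ↑ˡ b)) + sumF (λ (j : Fin b) → f (a ↑ʳ j))
sumF-↑ zero    b f = refl
sumF-↑ (suc a) b f = trans (cong (f fzero +_) (sumF-↑ a b (λ i → f (fsuc i))))
                           (sym (+-assoc (f fzero) _ _))

sumF-combine : ∀ m k (f : Fin (m * k) → ℕ) →
  sumF f ≡ sumF (λ (x : Fin m) → sumF (λ (i : Fin k) → f (combine x i)))
sumF-combine zero    k f = refl
sumF-combine (suc m) k f = trans (sumF-↑ k (m * k) f)
  (cong (sumF (λ (i : Fin k) → f (i ↑ˡ (m * k))) +_) (sumF-combine m k (λ z → f (k ↑ʳ z))))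

combine-elim : ∀ {m} k {P : Fin (m * k) → Set} → (∀ x i → P (combine x i)) → ∀ z → P z
combine-elim {m} k {P} p z =
  subst P (combine-remQuot {m} k z) (p (proj₁ (remQuot {m} k z)) (proj₂ (remQuot {m} k z)))

toℕ-combine-+ : ∀ {m k} (x : Fin m) (i : Fin k) {a} (i+a<k : toℕ i + a < k) →
  toℕ (combine x i) + a ≡ toℕ (combine x (fromℕ< i+a<k))
toℕ-combine-+ {k = k} x i {a} i+a<k = begin
  toℕ (combine x i) + a            ≡⟨ cong (_+ a) (toℕ-combine x i) ⟩
  k * toℕ x + toℕ i + a            ≡⟨ +-assoc (k * toℕ x) (toℕ i) a ⟩
  k * toℕ x + (toℕ i + a)          ≡⟨ cong (k * toℕ x +_) (sym (toℕ-fromℕ< i+a<k)) ⟩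
  k * toℕ x + toℕ (fromℕ< i+a<k)   ≡⟨ sym (toℕ-combine x (fromℕ< i+a<k)) ⟩
  toℕ (combine x (fromℕ< i+a<k))   ∎
  where open ≡-Reasoning

combine-+-< : ∀ {m k} (x : Fin m) (i : Fin k) {a} → toℕ i + a < k → toℕ (combine x i) + a < m * k
combine-+-< {m} {k} x i i+a<k =
  subst (_< m * k) (sym (toℕ-combine-+ x i i+a<k)) (toℕ<n (combine x (fromℕ< i+a<k)))

combine-+-injective : ∀ {m k} (x x′ : Fin m) (i i′ : Fin k) {a a′} →
  toℕ i + a < k → toℕ i′ + a′ < k → toℕ (combine x i) + a ≡ toℕ (combine x′ i′) + a′ →
  x ≡ x′ × toℕ i + a ≡ toℕ i′ + a′
combine-+-injective x x′ i i′ i+a<k i′+a′<k e =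
  combine-injectiveˡ x (fromℕ< i+a<k) x′ (fromℕ< i′+a′<k) same ,
  trans (sym (toℕ-fromℕ< i+a<k))
        (trans (cong toℕ (combine-injectiveʳ x (fromℕ< i+a<k) x′ (fromℕ< i′+a′<k) same))
               (toℕ-fromℕ< i′+a′<k))
  where
  same : combine x (fromℕ< i+a<k) ≡ combine x′ (fromℕ< i′+a′<k)
  same = toℕ-injective (trans (sym (toℕ-combine-+ x i i+a<k)) (trans e (toℕ-combine-+ x′ i′ i′+a′<k)))

IsPacking-cong : ∀ {T M N} {D D′ : Positions M N} → (∀ i j → D i j ≡ D′ i j) →
  IsPacking T M N D → IsPacking T M N D′
IsPacking-cong D≗D′ (inside , disjoint) =
  (λ i j d → inside i j (trans (D≗D′ i j) d)) ,
  (λ i j i′ j′ d d′ → disjoint i j i′ j′ (trans (D≗D′ i j) d) (trans (D≗D′ i′ j′) d′))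

-- A tile placed in a block stays inside that block, so tiles of different blocks never meet.
packing-from-blocks : ∀ {T m n k ℓ} (D : Positions (m * k) (n * ℓ)) →
  (∀ x y → IsPacking T k ℓ (block {m} {n} {k} {ℓ} D x y)) → IsPacking T (m * k) (n * ℓ) D
packing-from-blocks {T} {m} {n} {k} {ℓ} D blocks = inside , disjoint
  where
  inside : ∀ z w → D z w ≡ true → ∀ {a b} → (a , b) ∈ cells T →
    (toℕ z + a < m * k) × (toℕ w + b < n * ℓ)
  inside = combine-elim {m} k λ x i → combine-elim {n} ℓ λ y j → λ d cell →
    let (i+a<k , j+b<ℓ) = proj₁ (blocks x y) i j d cell
    in combine-+-< x i i+a<k , combine-+-< y j j+b<ℓ

  disjoint : ∀ z w z′ w′ → D z w ≡ true → D z′ w′ ≡ true → (z , w) ≢ (z′ , w′) →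
    ∀ {a b a′ b′} → (a , b) ∈ cells T → (a′ , b′) ∈ cells T →
    ¬ ((toℕ z + a ≡ toℕ z′ + a′) × (toℕ w + b ≡ toℕ w′ + b′))
  disjoint = combine-elim {m} k λ x i → combine-elim {n} ℓ λ y j →
             combine-elim {m} k λ x′ i′ → combine-elim {n} ℓ λ y′ j′ →
    λ d d′ distinct cell cell′ (row≡ , col≡) →
      let (i+a<k , j+b<ℓ) = proj₁ (blocks x y) i j d cell
          (i′+a′<k , j′+b′<ℓ) = proj₁ (blocks x′ y′) i′ j′ d′ cell′
      in separate d d′ distinct cell cell′
           (combine-+-injective x x′ i i′ i+a<k i′+a′<k row≡)
           (combine-+-injective y y′ j j′ j+b<ℓ j′+b′<ℓ col≡)
    where
    separate : ∀ {x x′ i i′ y y′ j j′ a b a′ b′} →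
      D (combine x i) (combine y j) ≡ true → D (combine x′ i′) (combine y′ j′) ≡ true →
      (combine x i , combine y j) ≢ (combine x′ i′ , combine y′ j′) →
      (a , b) ∈ cells T → (a′ , b′) ∈ cells T →
      x ≡ x′ × toℕ i + a ≡ toℕ i′ + a′ → y ≡ y′ × toℕ j + b ≡ toℕ j′ + b′ → ⊥
    separate {x} {i = i} {i′} {y} {j = j} {j′} d d′ distinct cell cell′ (refl , row≡) (refl , col≡) =
      proj₂ (blocks x y) i j i′ j′ d d′
        (λ same → distinct (cong (λ p → combine x (proj₁ p) , combine y (proj₂ p)) same))
        cell cell′ (row≡ , col≡)

glue : ∀ {m n k ℓ} → (Fin m → Fin n → Positions k ℓ) → Positions (m * k) (n * ℓ)
glue {m} {n} {k} {ℓ} E z w =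
  E (proj₁ (remQuot {m} k z)) (proj₁ (remQuot {n} ℓ w)) (proj₂ (remQuot {m} k z)) (proj₂ (remQuot {n} ℓ w))

block-glue : ∀ {m n k ℓ} (E : Fin m → Fin n → Positions k ℓ) x y i j →
  block {m} {n} {k} {ℓ} (glue E) x y i j ≡ E x y i j
block-glue {m} {n} {k} {ℓ} E x y i j =
  cong₂ (λ p q → E (proj₁ p) (proj₁ q) (proj₂ p) (proj₂ q))
        (remQuot-combine {m} {k} x i) (remQuot-combine {n} {ℓ} y j)

rowProj-cong : ∀ {M N} {D D′ : Positions M N} → (∀ i j → D i j ≡ D′ i j) → ∀ i → rowProj D i ≡ rowProj D′ i
rowProj-cong D≗D′ i = sumF-cong (λ j → cong (λ t → if t then 1 else 0) (D≗D′ i j))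

rJ-combine : ∀ {m k} (r : Color → Fin m → ℕ) (v : Color → Fin k → ℕ) x i →
  rJ {m} k r v (combine x i) ≡ ΣColor (λ c → r c x * v c i)
rJ-combine {m} {k} r v x i =
  cong (λ p → ΣColor (λ c → r c (proj₁ p) * v c (proj₂ p))) (remQuot-combine {m} {k} x i)

-- Column projections of D are, definitionally, row projections of flip D, so this also covers columns.
rowProj≡rJ⇔line-sums : ∀ {m n k ℓ} (D : Positions (m * k) (n * ℓ)) (M : Fin m → Fin n → Color)
  (r : Color → Fin m → ℕ) (v : Color → Fin k → ℕ) →
  (∀ x y i → rowProj (block {m} {n} {k} {ℓ} D x y) i ≡ v (M x y) i) →
  (∀ z → rowProj D z ≡ rJ {m} k r v z) ⇔ (∀ x i → sumF (λ y → v (M x y) i) ≡ ΣColor (λ c → r c x * v c i))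
rowProj≡rJ⇔line-sums {m} {n} {k} {ℓ} D M r v blockRows = mk⇔
  (λ rows x i → trans (sym (rowProj-by-blocks x i)) (trans (rows (combine x i)) (rJ-combine r v x i)))
  (λ sums → combine-elim {m} k λ x i →
    trans (rowProj-by-blocks x i) (trans (sums x i) (sym (rJ-combine r v x i))))
  where
  rowProj-by-blocks : ∀ x i → rowProj D (combine x i) ≡ sumF (λ y → v (M x y) i)
  rowProj-by-blocks x i = trans (sumF-combine n ℓ (λ w → if D (combine x i) w then 1 else 0))
                                (sumF-cong (λ y → blockRows x y i))

coloring⇒packing : ∀ {T k ℓ m n} (Dbar : Color → Positions k ℓ) (rbar : Color → Fin k → ℕ)
  (sbar : Color → Fin ℓ → ℕ) (r : Color → Fin m → ℕ) (s : Color → Fin n → ℕ) →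
  (∀ c → IsPacking T k ℓ (Dbar c)) →
  (∀ c i → rowProj (Dbar c) i ≡ rbar c i) → (∀ c j → colProj (Dbar c) j ≡ sbar c j) →
  ThreeColorSolvable m n r s → TPTPSolvable T (m * k) (n * ℓ) (rJ {m} k r rbar) (rJ {n} ℓ s sbar)
coloring⇒packing {T} {k} {ℓ} {m} {n} Dbar rbar sbar r s Dbar-packing Dbar-rows Dbar-cols (M , rows , cols) =
  D , packing , D-rows , D-cols
  where
  D : Positions (m * k) (n * ℓ)
  D = glue (λ x y → Dbar (M x y))

  packing : IsPacking T (m * k) (n * ℓ) D
  packing = packing-from-blocks {T} {m} {n} {k} {ℓ} D λ x y →
    IsPacking-cong {T} (λ i j → sym (block-glue (λ x y → Dbar (M x y)) x y i j)) (Dbar-packing (M x y))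

  D-rows : ∀ z → rowProj D z ≡ rJ {m} k r rbar z
  D-rows = Equivalence.from
    (rowProj≡rJ⇔line-sums D M r rbar λ x y i →
      trans (rowProj-cong (block-glue (λ x y → Dbar (M x y)) x y) i) (Dbar-rows (M x y) i))
    (λ x → color-counts⇒line-sums (M x) rbar (λ c → r c x) (λ c → rows c x))

  D-cols : ∀ w → colProj D w ≡ rJ {n} ℓ s sbar w
  D-cols = Equivalence.from
    (rowProj≡rJ⇔line-sums (flip D) (flip M) s sbar λ y x j →
      trans (rowProj-cong (λ j i → block-glue (λ x y → Dbar (M x y)) x y i j) j) (Dbar-cols (M x y) j))
    (λ y → color-counts⇒line-sums (λ x → M x y) sbar (λ c → s c y) (λ c → cols c y))

block-coloring-solves : ∀ {k ℓ m n} (rbar : Color → Fin k → ℕ) (sbar : Color → Fin ℓ → ℕ)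
  (r : Color → Fin m → ℕ) (s : Color → Fin n → ℕ) →
  (∀ x → ΣColor (λ c → r c x) ≡ n) → (∀ y → ΣColor (λ c → s c y) ≡ m) →
  AffinelyIndependent3 rbar → AffinelyIndependent3 sbar →
  (D : Positions (m * k) (n * ℓ)) →
  (∀ z → rowProj D z ≡ rJ {m} k r rbar z) → (∀ w → colProj D w ≡ rJ {n} ℓ s sbar w) →
  (M : Fin m → Fin n → Color) →
  (∀ x y i → rowProj (block {m} {n} {k} {ℓ} D x y) i ≡ rbar (M x y) i) →
  (∀ x y j → colProj (block {m} {n} {k} {ℓ} D x y) j ≡ sbar (M x y) j) →
  (∀ c x → countF (λ y → M x y ==ᶜ c) ≡ r c x) × (∀ c y → countF (λ x → M x y ==ᶜ c) ≡ s c y)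
block-coloring-solves rbar sbar r s r-total s-total rbar-independent sbar-independent
                       D rows cols M blockRows blockCols =
  (λ c x → line-sums⇒color-counts (M x) rbar (λ c → r c x) rbar-independent (r-total x)
             (Equivalence.to (rowProj≡rJ⇔line-sums D M r rbar blockRows) rows x) c) ,
  (λ c y → line-sums⇒color-counts (λ x → M x y) sbar (λ c → s c y) sbar-independent (s-total y)
             (Equivalence.to (rowProj≡rJ⇔line-sums (flip D) (flip M) s sbar (λ y x → blockCols x y)) cols y) c)

-- Unused hypotheses: the tile not being a bar (in the paper it serves to establish Requirement 2),
-- positivity of k and ℓ, and equality of the color totals.
lemma2 : (T : Tile) → ¬ IsBar T → (k ℓ : ℕ) → 0 < k → 0 < ℓ →
    (Dbar : Color → Positions k ℓ) → (∀ c → IsPacking T k ℓ (Dbar c)) →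
    (rbar : Color → Fin k → ℕ) → (sbar : Color → Fin ℓ → ℕ) →
    (∀ c i → rowProj (Dbar c) i ≡ rbar c i) → (∀ c j → colProj (Dbar c) j ≡ sbar c j) →
    (m n : ℕ) → (r : Color → Fin m → ℕ) → (s : Color → Fin n → ℕ) →
    (∀ c → sumF (r c) ≡ sumF (s c)) →
    (∀ x → ΣColor (λ c → r c x) ≡ n) →
    (∀ y → ΣColor (λ c → s c y) ≡ m) →
    AffinelyIndependent3 rbar → AffinelyIndependent3 sbar →
    (∀ (D : Positions (m * k) (n * ℓ)) → IsPacking T (m * k) (n * ℓ) D →
      (∀ i → rowProj D i ≡ rJ {m} k r rbar i) → (∀ j → colProj D j ≡ rJ {n} ℓ s sbar j) →
      ∀ x y → IsPacking T k ℓ (block {m} {n} {k} {ℓ} D x y)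
        × ∃[ c ] ((∀ i → rowProj (block {m} {n} {k} {ℓ} D x y) i ≡ rbar c i)
                 × (∀ j → colProj (block {m} {n} {k} {ℓ} D x y) j ≡ sbar c j))) →
    ThreeColorSolvable m n r s ⇔ TPTPSolvable T (m * k) (n * ℓ) (rJ {m} k r rbar) (rJ {n} ℓ s sbar)
lemma2 T _ k ℓ _ _ Dbar Dbar-packing rbar sbar Dbar-rows Dbar-cols m n r s _
       r-total s-total rbar-independent sbar-independent blocks-colored =
  mk⇔ (coloring⇒packing {T} Dbar rbar sbar r s Dbar-packing Dbar-rows Dbar-cols) packing⇒coloring
  where
  packing⇒coloring : TPTPSolvable T (m * k) (n * ℓ) (rJ {m} k r rbar) (rJ {n} ℓ s sbar) →
    ThreeColorSolvable m n r s
  packing⇒coloring (D , packing , rows , cols) =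
    M , block-coloring-solves rbar sbar r s r-total s-total rbar-independent sbar-independent
          D rows cols M (λ x y → proj₁ (proj₂ (colored x y))) (λ x y → proj₂ (proj₂ (colored x y)))
    where
    colored : ∀ x y → ∃[ c ] ((∀ i → rowProj (block {m} {n} {k} {ℓ} D x y) i ≡ rbar c i)
                              × (∀ j → colProj (block {m} {n} {k} {ℓ} D x y) j ≡ sbar c j))
    colored x y = proj₂ (blocks-colored D packing rows cols x y)

    M : Fin m → Fin n → Color
    M x y = proj₁ (colored x y)
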